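{- Fix a positive integer $k$ and let $A_1,\dots,A_k\subset\mathbb{N}_0^2$ be finite non-empty sets. Choose an integer $m>k\cdot M$, where $M$ is the largest coordinate of any point in $A_1\cup\cdots\cup A_k$. Let $C=A_1+m\cdot A_2+\cdots+m^{k-1}\cdot A_k$. Then $$|sC-dC|=\prod_{j=1}^k|sA_j-dA_j|$$ for all non-negative integers $s,d$ with $s+d\leq k$.
   Context: $\mathbb{N}_0=\{0,1,2,\dots\}$. For finite $X\subset\mathbb{Z}^2$ and non-negative integers $s,d$, $sX-dX=\{u_1+\cdots+u_s-v_1-\cdots-v_d:u_i,v_j\in X\}$ (empty sums equal $0$); $m^{i}\cdot X=\{m^iv:v\in X\}$, and the sum of sets is the sumset. -}

module Defs where

open import Data.Nat as ℕ using (ℕ; zero; suc; _⊔_)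
open import Data.Integer as ℤ using (ℤ; +_)
open import Data.Product using (_×_; _,_; proj₁; proj₂)
open import Data.Product.Properties using (≡-dec)
open import Data.List using (List; []; _∷_; map; concatMap; foldr; length; deduplicate; allFin)
open import Data.Fin using (Fin; toℕ)
open import Relation.Nullary using (Dec)
open import Relation.Binary.PropositionalEquality using (_≡_)
open import Data.Unit using (⊤)
open import Data.Empty using (⊥)

NonEmpty : ∀ {a} {A : Set a} → List A → Set
NonEmpty [] = ⊥
NonEmpty (_ ∷ _) = ⊤

Point : Set
Point = ℤ × ℤ

_≟ₚ_ : (p q : Point) → Dec (p ≡ q)
_≟ₚ_ = ≡-dec ℤ._≟_ ℤ._≟_

origin : Point
origin = (+ 0 , + 0)

_⊕_ : Point → Point → Point
(a , b) ⊕ (c , d) = (a ℤ.+ c , b ℤ.+ d)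

negP : Point → Point
negP (a , b) = (ℤ.- a , ℤ.- b)

scaleP : ℤ → Point → Point
scaleP t (a , b) = (t ℤ.* a , t ℤ.* b)

-- Finite subsets of ℤ² are represented by lists (duplicates allowed);
-- the set is the set of list members.

card : List Point → ℕ
card X = length (deduplicate _≟ₚ_ X)

_+ˢ_ : List Point → List Point → List Point
X +ˢ Y = concatMap (λ u → map (u ⊕_) Y) X

_·ˢ_ : ℤ → List Point → List Point
t ·ˢ X = map (scaleP t) X

mulSet : ℕ → List Point → List Point
mulSet zero X = origin ∷ []
mulSet (suc s) X = X +ˢ mulSet s X

sdSet : ℕ → ℕ → List Point → List Point
sdSet s d X = mulSet s X +ˢ map negP (mulSet d X)

embed : List (ℕ × ℕ) → List Point
embed = map (λ p → (+ proj₁ p , + proj₂ p))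

maxCoord : ∀ {k} → (Fin k → List (ℕ × ℕ)) → ℕ
maxCoord {k} A = foldr (λ j acc → foldr (λ p r → proj₁ p ⊔ proj₂ p ⊔ r) acc (A j)) 0 (allFin k)

bigSum : List (List Point) → List Point
bigSum = foldr _+ˢ_ (origin ∷ [])

-- C = A_1 + m·A_2 + ... + m^{k-1}·A_k   (A indexed by Fin k, j ↦ m^j · A j)
Cset : ∀ {k} → ℕ → (Fin k → List (ℕ × ℕ)) → List Point
Cset {k} m A = bigSum (map (λ j → (+ (m ℕ.^ toℕ j)) ·ˢ embed (A j)) (allFin k))

{-# OPTIONS --safe #-}
-- In Horner form C = A₁ + m·C′ with C′ = A₂ + m·(A₃ + ⋯). The operation X ↦ sX − dX
-- distributes over sumsets and commutes with dilation, so sC − dC = (sA₁ − dA₁) + m·(sC′ − dC′).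
-- The coordinates of sA₁ − dA₁ lie in [−dM, sM], a window of width (s + d)M < m, so in a sum
-- p + m·q the point p is recovered as the "last base-m digit": the sumset is direct and its
-- size is the product of the sizes.
module Submission where

open import Defs

open import Data.Nat as ℕ using (ℕ; zero; suc; _+_; _*_; _^_; _≤_; _<_; _⊔_)
import Data.Nat.Properties as ℕ
open import Data.Nat.ListAction using (product)
open import Data.Integer as ℤ using (ℤ; +_; -_; _-_; ∣_∣)
import Data.Integer.Properties as ℤ
open import Data.Integer.Tactic.RingSolver using (solve-∀)
import Algebra.Properties.CommutativeSemigroup as CommSemigroupProperties
import Algebra.Properties.Group as GroupProperties
open import Data.Fin using (Fin; toℕ) renaming (zero to fzero; suc to fsuc)
open import Data.Product using (_×_; _,_; proj₁; proj₂; ∃₂)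
open import Data.Product.Properties using (,-injective)
open import Data.List using (List; []; _∷_; map; _++_; foldr; length; deduplicate; allFin; cartesianProductWith)
open import Data.List.Properties using (length-++; length-map; map-++; map-∘; map-cong; map-id; map-tabulate)
open import Data.List.Membership.Propositional using (_∈_)
open import Data.List.Membership.Propositional.Properties
  using (∈-map⁻; ∈-cartesianProductWith⁺; ∈-cartesianProductWith⁻; ∈-deduplicate⁺; ∈-deduplicate⁻; ∈-allFin)
open import Data.List.Membership.Propositional.Properties.WithK using (unique∧set⇒bag)
open import Data.List.Relation.Binary.BagAndSetEquality as BagSet using (_∼[_]_; set; [_]-Equality; ∼bag⇒↭)
open import Data.List.Relation.Binary.Permutation.Propositional.Properties using (↭-length)
open import Data.List.Relation.Unary.Any using (here; there)
open import Data.List.Relation.Unary.All as All using ()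
open import Data.List.Relation.Unary.Unique.Propositional using (Unique; []; _∷_)
open import Data.List.Relation.Unary.Unique.Propositional.Properties using (++⁺; map⁺)
open import Data.List.Relation.Unary.Unique.DecPropositional.Properties using (deduplicate-!)
open import Data.Empty using (⊥)
open import Function using (_∘_)
open import Function.Bundles using (mk⇔)
open import Algebra.Bundles using (AbelianGroup)
open import Relation.Binary.Bundles using (Setoid)
import Relation.Binary.Reasoning.Setoid as SetoidReasoning
open import Relation.Binary.PropositionalEquality
  using (_≡_; refl; sym; trans; cong; cong₂; subst; module ≡-Reasoning)

private
  module ℤ+ = CommSemigroupProperties ℤ.+-commutativeSemigroup
  module ℤ+G = GroupProperties (AbelianGroup.group ℤ.+-0-abelianGroup)
  module SetEq = Setoid ([ set ]-Equality Point)
  module SetReasoning = SetoidReasoning ([ set ]-Equality Point)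

⊕-interchange : ∀ p q r t → (p ⊕ q) ⊕ (r ⊕ t) ≡ (p ⊕ r) ⊕ (q ⊕ t)
⊕-interchange (a , a′) (b , b′) (c , c′) (e , e′) =
  cong₂ _,_ (ℤ+.interchange a b c e) (ℤ+.interchange a′ b′ c′ e′)

⊕-cancelˡ : ∀ p {q r} → p ⊕ q ≡ p ⊕ r → q ≡ r
⊕-cancelˡ (a , a′) {b , b′} {c , c′} eq =
  cong₂ _,_ (ℤ+G.∙-cancelˡ a b c (proj₁ (,-injective eq))) (ℤ+G.∙-cancelˡ a′ b′ c′ (proj₂ (,-injective eq)))

negP-⊕ : ∀ p q → negP (p ⊕ q) ≡ negP p ⊕ negP q
negP-⊕ (a , a′) (b , b′) = cong₂ _,_ (ℤ.neg-distrib-+ a b) (ℤ.neg-distrib-+ a′ b′)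

scaleP-⊕ : ∀ t p q → scaleP t (p ⊕ q) ≡ scaleP t p ⊕ scaleP t q
scaleP-⊕ t (a , a′) (b , b′) = cong₂ _,_ (ℤ.*-distribˡ-+ t a b) (ℤ.*-distribˡ-+ t a′ b′)

scaleP-origin : ∀ t → scaleP t origin ≡ origin
scaleP-origin t = cong₂ _,_ (ℤ.*-zeroʳ t) (ℤ.*-zeroʳ t)

scaleP-negP : ∀ t p → scaleP t (negP p) ≡ negP (scaleP t p)
scaleP-negP t (a , a′) = cong₂ _,_ (sym (ℤ.neg-distribʳ-* t a)) (sym (ℤ.neg-distribʳ-* t a′))

scaleP-identity : ∀ p → scaleP (+ 1) p ≡ p
scaleP-identity (a , a′) = cong₂ _,_ (ℤ.*-identityˡ a) (ℤ.*-identityˡ a′)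

scaleP-* : ∀ t u p → scaleP (t ℤ.* u) p ≡ scaleP t (scaleP u p)
scaleP-* t u (a , a′) = cong₂ _,_ (ℤ.*-assoc t u a) (ℤ.*-assoc t u a′)

scaleP-injective : ∀ t .{{_ : ℤ.NonZero t}} {p q} → scaleP t p ≡ scaleP t q → p ≡ q
scaleP-injective t {a , a′} {b , b′} eq =
  cong₂ _,_ (ℤ.*-cancelˡ-≡ t a b (proj₁ (,-injective eq))) (ℤ.*-cancelˡ-≡ t a′ b′ (proj₂ (,-injective eq)))

+ˢ≡cartesianProductWith : ∀ X Y → X +ˢ Y ≡ cartesianProductWith _⊕_ X Y
+ˢ≡cartesianProductWith []      Y = refl
+ˢ≡cartesianProductWith (x ∷ X) Y = cong (map (x ⊕_) Y ++_) (+ˢ≡cartesianProductWith X Y)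

∈-+ˢ⁺ : ∀ {X Y p q} → p ∈ X → q ∈ Y → p ⊕ q ∈ X +ˢ Y
∈-+ˢ⁺ {X} {Y} p∈X q∈Y =
  subst (_ ∈_) (sym (+ˢ≡cartesianProductWith X Y)) (∈-cartesianProductWith⁺ _⊕_ p∈X q∈Y)

∈-+ˢ⁻ : ∀ X Y {r} → r ∈ X +ˢ Y → ∃₂ λ p q → p ∈ X × q ∈ Y × r ≡ p ⊕ q
∈-+ˢ⁻ X Y r∈ = ∈-cartesianProductWith⁻ _⊕_ X Y (subst (_ ∈_) (+ˢ≡cartesianProductWith X Y) r∈)

length-+ˢ : ∀ X Y → length (X +ˢ Y) ≡ length X * length Y
length-+ˢ []      Y = refl
length-+ˢ (x ∷ X) Y =
  trans (length-++ (map (x ⊕_) Y)) (cong₂ _+_ (length-map (x ⊕_) Y) (length-+ˢ X Y))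

+ˢ-cong : ∀ {X X′ Y Y′} → X ∼[ set ] X′ → Y ∼[ set ] Y′ → X +ˢ Y ∼[ set ] X′ +ˢ Y′
+ˢ-cong X∼X′ Y∼Y′ = BagSet.>>=-cong X∼X′ (λ _ → BagSet.map-cong (λ _ → refl) Y∼Y′)

+ˢ-interchange : ∀ W X Y Z → (W +ˢ X) +ˢ (Y +ˢ Z) ∼[ set ] (W +ˢ Y) +ˢ (X +ˢ Z)
+ˢ-interchange W X Y Z = mk⇔ (interchange⊆ W X Y Z) (interchange⊆ W Y X Z)
  where
  interchange⊆ : ∀ W X Y Z {r} → r ∈ (W +ˢ X) +ˢ (Y +ˢ Z) → r ∈ (W +ˢ Y) +ˢ (X +ˢ Z)
  interchange⊆ W X Y Z r∈ with ∈-+ˢ⁻ (W +ˢ X) (Y +ˢ Z) r∈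
  ... | _ , _ , wx∈ , yz∈ , refl with ∈-+ˢ⁻ W X wx∈ | ∈-+ˢ⁻ Y Z yz∈
  ... | w , x , w∈ , x∈ , refl | y , z , y∈ , z∈ , refl =
    subst (_∈ _) (sym (⊕-interchange w x y z)) (∈-+ˢ⁺ (∈-+ˢ⁺ w∈ y∈) (∈-+ˢ⁺ x∈ z∈))

map-+ˢ : ∀ (f : Point → Point) → (∀ p q → f (p ⊕ q) ≡ f p ⊕ f q) →
         ∀ X Y → map f (X +ˢ Y) ≡ map f X +ˢ map f Y
map-+ˢ f f-⊕ []      Y = refl
map-+ˢ f f-⊕ (x ∷ X) Y = begin
  map f (map (x ⊕_) Y ++ (X +ˢ Y))         ≡⟨ map-++ f (map (x ⊕_) Y) (X +ˢ Y) ⟩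
  map f (map (x ⊕_) Y) ++ map f (X +ˢ Y)   ≡⟨ cong₂ _++_ translate (map-+ˢ f f-⊕ X Y) ⟩
  map (f x ⊕_) (map f Y) ++ (map f X +ˢ map f Y) ∎
  where
  open ≡-Reasoning
  translate : map f (map (x ⊕_) Y) ≡ map (f x ⊕_) (map f Y)
  translate = trans (sym (map-∘ Y)) (trans (map-cong (f-⊕ x) Y) (map-∘ Y))

mulSet-map : ∀ (f : Point → Point) → (∀ p q → f (p ⊕ q) ≡ f p ⊕ f q) → f origin ≡ origin →
             ∀ s X → mulSet s (map f X) ≡ map f (mulSet s X)
mulSet-map f f-⊕ f-origin zero    X = cong (_∷ []) (sym f-origin)
mulSet-map f f-⊕ f-origin (suc s) X =
  trans (cong (map f X +ˢ_) (mulSet-map f f-⊕ f-origin s X)) (sym (map-+ˢ f f-⊕ X (mulSet s X)))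

mulSet-origin : ∀ s → mulSet s (origin ∷ []) ≡ origin ∷ []
mulSet-origin zero    = refl
mulSet-origin (suc s) rewrite mulSet-origin s = refl

mulSet-+ˢ : ∀ s X Y → mulSet s (X +ˢ Y) ∼[ set ] mulSet s X +ˢ mulSet s Y
mulSet-+ˢ zero    X Y = SetEq.refl
mulSet-+ˢ (suc s) X Y = SetEq.trans (+ˢ-cong {X +ˢ Y} SetEq.refl (mulSet-+ˢ s X Y))
                                    (+ˢ-interchange X Y (mulSet s X) (mulSet s Y))

sdSet-+ˢ : ∀ s d X Y → sdSet s d (X +ˢ Y) ∼[ set ] sdSet s d X +ˢ sdSet s d Y
sdSet-+ˢ s d X Y = begin
  mulSet s (X +ˢ Y) +ˢ map negP (mulSet d (X +ˢ Y))
    ≈⟨ +ˢ-cong (mulSet-+ˢ s X Y) (BagSet.map-cong (λ _ → refl) (mulSet-+ˢ d X Y)) ⟩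
  (mulSet s X +ˢ mulSet s Y) +ˢ map negP (mulSet d X +ˢ mulSet d Y)
    ≡⟨ cong ((mulSet s X +ˢ mulSet s Y) +ˢ_) (map-+ˢ negP negP-⊕ (mulSet d X) (mulSet d Y)) ⟩
  (mulSet s X +ˢ mulSet s Y) +ˢ (map negP (mulSet d X) +ˢ map negP (mulSet d Y))
    ≈⟨ +ˢ-interchange (mulSet s X) (mulSet s Y) (map negP (mulSet d X)) (map negP (mulSet d Y)) ⟩
  sdSet s d X +ˢ sdSet s d Y ∎
  where open SetReasoning

sdSet-·ˢ : ∀ s d t X → sdSet s d (t ·ˢ X) ≡ t ·ˢ sdSet s d X
sdSet-·ˢ s d t X = begin
  mulSet s (t ·ˢ X) +ˢ map negP (mulSet d (t ·ˢ X))
    ≡⟨ cong₂ (λ P Q → P +ˢ map negP Q) (mulSet-scale s) (mulSet-scale d) ⟩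
  (t ·ˢ mulSet s X) +ˢ map negP (t ·ˢ mulSet d X)
    ≡⟨ cong ((t ·ˢ mulSet s X) +ˢ_) negP-·ˢ ⟩
  (t ·ˢ mulSet s X) +ˢ (t ·ˢ map negP (mulSet d X))
    ≡⟨ map-+ˢ (scaleP t) (scaleP-⊕ t) (mulSet s X) (map negP (mulSet d X)) ⟨
  t ·ˢ sdSet s d X ∎
  where
  open ≡-Reasoning
  mulSet-scale : ∀ n → mulSet n (t ·ˢ X) ≡ t ·ˢ mulSet n X
  mulSet-scale n = mulSet-map (scaleP t) (scaleP-⊕ t) (scaleP-origin t) n X
  negP-·ˢ : map negP (t ·ˢ mulSet d X) ≡ t ·ˢ map negP (mulSet d X)
  negP-·ˢ = trans (sym (map-∘ (mulSet d X)))
                  (trans (map-cong (sym ∘ scaleP-negP t) (mulSet d X)) (map-∘ (mulSet d X)))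

deduplicate-∼ : ∀ X → X ∼[ set ] deduplicate _≟ₚ_ X
deduplicate-∼ X = mk⇔ (∈-deduplicate⁺ _≟ₚ_) (∈-deduplicate⁻ _≟ₚ_ X)

card-unique : ∀ {X U} → Unique U → X ∼[ set ] U → card X ≡ length U
card-unique {X} U! X∼U = ↭-length (∼bag⇒↭ (unique∧set⇒bag (deduplicate-! _≟ₚ_ X) U!
  (SetEq.trans (SetEq.sym (deduplicate-∼ X)) X∼U)))

card-cong : ∀ {X Y} → X ∼[ set ] Y → card X ≡ card Y
card-cong {Y = Y} X∼Y = card-unique (deduplicate-! _≟ₚ_ Y) (SetEq.trans X∼Y (deduplicate-∼ Y))

card-map : ∀ (f : Point → Point) → (∀ {p q} → f p ≡ f q → p ≡ q) → ∀ X → card (map f X) ≡ card X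
card-map f f-injective X = trans
  (card-unique (map⁺ f-injective (deduplicate-! _≟ₚ_ X)) (BagSet.map-cong (λ _ → refl) (deduplicate-∼ X)))
  (length-map f (deduplicate _≟ₚ_ X))

-- The Y-summands then agree as well, by cancellation.
DirectSum : List Point → List Point → Set
DirectSum X Y = ∀ {p p′ q q′} → p ∈ X → p′ ∈ X → q ∈ Y → q′ ∈ Y → p ⊕ q ≡ p′ ⊕ q′ → p ≡ p′

+ˢ-unique : ∀ X Y → Unique X → Unique Y → DirectSum X Y → Unique (X +ˢ Y)
+ˢ-unique []      Y _           _  _      = []
+ˢ-unique (x ∷ X) Y (x∉X ∷ X!) Y! direct =
  ++⁺ (map⁺ (⊕-cancelˡ x) Y!) (+ˢ-unique X Y X! Y! (λ p∈ p′∈ → direct (there p∈) (there p′∈))) disjoint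
  where
  disjoint : ∀ {r} → r ∈ map (x ⊕_) Y × r ∈ X +ˢ Y → ⊥
  disjoint (r∈xY , r∈XY) with ∈-map⁻ (x ⊕_) r∈xY | ∈-+ˢ⁻ X Y r∈XY
  ... | q , q∈ , refl | p , q′ , p∈ , q′∈ , eq = All.lookup x∉X p∈ (direct (here refl) (there p∈) q∈ q′∈ eq)

card-+ˢ : ∀ X Y → DirectSum X Y → card (X +ˢ Y) ≡ card X * card Y
card-+ˢ X Y direct = trans
  (card-unique (+ˢ-unique X′ Y′ (deduplicate-! _≟ₚ_ X) (deduplicate-! _≟ₚ_ Y) direct′)
               (+ˢ-cong (deduplicate-∼ X) (deduplicate-∼ Y)))
  (length-+ˢ X′ Y′)
  where
  X′ = deduplicate _≟ₚ_ X
  Y′ = deduplicate _≟ₚ_ Y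
  direct′ : DirectSum X′ Y′
  direct′ p∈ p′∈ q∈ q′∈ = direct (∈-deduplicate⁻ _≟ₚ_ X p∈) (∈-deduplicate⁻ _≟ₚ_ X p′∈)
                                 (∈-deduplicate⁻ _≟ₚ_ Y q∈) (∈-deduplicate⁻ _≟ₚ_ Y q′∈)

digit-unique : ∀ m {x y v w} → ∣ x - y ∣ < m → x ℤ.+ + m ℤ.* v ≡ y ℤ.+ + m ℤ.* w → x ≡ y
digit-unique m {x} {y} {v} {w} ∣x-y∣<m eq =
  ℤ+G.∙-cancelʳ (+ m ℤ.* v) x y (trans eq (cong (λ u → y ℤ.+ + m ℤ.* u) (sym v≡w)))
  where
  difference : x - y ≡ + m ℤ.* (w - v)
  difference = begin
    x - y                                       ≡⟨ shift x y (+ m ℤ.* v) ⟩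
    (x ℤ.+ + m ℤ.* v) - (y ℤ.+ + m ℤ.* v)       ≡⟨ cong (_- (y ℤ.+ + m ℤ.* v)) eq ⟩
    (y ℤ.+ + m ℤ.* w) - (y ℤ.+ + m ℤ.* v)       ≡⟨ factor y (+ m) w v ⟩
    + m ℤ.* (w - v)                             ∎
    where
    open ≡-Reasoning
    shift : ∀ a b c → a - b ≡ (a ℤ.+ c) - (b ℤ.+ c)
    shift = solve-∀
    factor : ∀ a c e f → (a ℤ.+ c ℤ.* e) - (a ℤ.+ c ℤ.* f) ≡ c ℤ.* (e - f)
    factor = solve-∀
  m*∣w-v∣<m*1 : m * ∣ w - v ∣ < m * 1
  m*∣w-v∣<m*1 = begin-strict
    m * ∣ w - v ∣          ≡⟨ ℤ.abs-* (+ m) (w - v) ⟨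
    ∣ + m ℤ.* (w - v) ∣    ≡⟨ cong ∣_∣ difference ⟨
    ∣ x - y ∣              <⟨ ∣x-y∣<m ⟩
    m                      ≡⟨ ℕ.*-identityʳ m ⟨
    m * 1                  ∎
    where open ℕ.≤-Reasoning
  v≡w : v ≡ w
  v≡w = sym (ℤ.i-j≡0⇒i≡j w v (ℤ.∣i∣≡0⇒i≡0 (ℕ.n<1⇒n≡0 (ℕ.*-cancelˡ-< m _ _ m*∣w-v∣<m*1))))

∣i+j-[k+l]∣≤∣i-k∣+∣j-l∣ : ∀ i j k l → ∣ (i ℤ.+ j) - (k ℤ.+ l) ∣ ≤ ∣ i - k ∣ + ∣ j - l ∣
∣i+j-[k+l]∣≤∣i-k∣+∣j-l∣ i j k l =
  subst (λ z → ∣ z ∣ ≤ ∣ i - k ∣ + ∣ j - l ∣) (sym (regroup i j k l)) (ℤ.∣i+j∣≤∣i∣+∣j∣ (i - k) (j - l))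
  where
  regroup : ∀ i j k l → (i ℤ.+ j) - (k ℤ.+ l) ≡ (i - k) ℤ.+ (j - l)
  regroup = solve-∀

∣-i--j∣≡∣i-j∣ : ∀ i j → ∣ - i - - j ∣ ≡ ∣ i - j ∣
∣-i--j∣≡∣i-j∣ i j = trans (cong ∣_∣ (sym (ℤ.neg-distrib-+ i (- j)))) (ℤ.∣-i∣≡∣i∣ (i - j))

Close : ℕ → Point → Point → Set
Close w (a , a′) (b , b′) = ∣ a - b ∣ ≤ w × ∣ a′ - b′ ∣ ≤ w

Diam≤ : ℕ → List Point → Set
Diam≤ w X = ∀ {p q} → p ∈ X → q ∈ X → Close w p q

close-⊕ : ∀ {v w p p′ q q′} → Close v p p′ → Close w q q′ → Close (v + w) (p ⊕ q) (p′ ⊕ q′)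
close-⊕ {p = a , a′} {b , b′} {c , c′} {e , e′} (ab , a′b′) (ce , c′e′) =
  ℕ.≤-trans (∣i+j-[k+l]∣≤∣i-k∣+∣j-l∣ a c b e) (ℕ.+-mono-≤ ab ce) ,
  ℕ.≤-trans (∣i+j-[k+l]∣≤∣i-k∣+∣j-l∣ a′ c′ b′ e′) (ℕ.+-mono-≤ a′b′ c′e′)

close-negP : ∀ {w p q} → Close w p q → Close w (negP p) (negP q)
close-negP {p = a , a′} {b , b′} (ab , a′b′) =
  subst (_≤ _) (sym (∣-i--j∣≡∣i-j∣ a b)) ab , subst (_≤ _) (sym (∣-i--j∣≡∣i-j∣ a′ b′)) a′b′

diam-+ˢ : ∀ {v w X Y} → Diam≤ v X → Diam≤ w Y → Diam≤ (v + w) (X +ˢ Y)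
diam-+ˢ {X = X} {Y} X≤ Y≤ r∈ r′∈ with ∈-+ˢ⁻ X Y r∈ | ∈-+ˢ⁻ X Y r′∈
... | p , q , p∈ , q∈ , refl | p′ , q′ , p′∈ , q′∈ , refl = close-⊕ {p = p} {p′} {q} {q′} (X≤ p∈ p′∈) (Y≤ q∈ q′∈)

diam-negP : ∀ {w X} → Diam≤ w X → Diam≤ w (map negP X)
diam-negP X≤ r∈ r′∈ with ∈-map⁻ negP r∈ | ∈-map⁻ negP r′∈
... | p , p∈ , refl | p′ , p′∈ , refl = close-negP {p = p} {p′} (X≤ p∈ p′∈)

diam-mulSet : ∀ {w X} s → Diam≤ w X → Diam≤ (s * w) (mulSet s X)
diam-mulSet zero    X≤ (here refl) (here refl) = ℕ.z≤n , ℕ.z≤n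
diam-mulSet (suc s) X≤ = diam-+ˢ X≤ (diam-mulSet s X≤)

diam-sdSet : ∀ {w X} s d → Diam≤ w X → Diam≤ ((s + d) * w) (sdSet s d X)
diam-sdSet {w} {X} s d X≤ = subst (λ n → Diam≤ n (sdSet s d X)) (sym (ℕ.*-distribʳ-+ w s d))
  (diam-+ˢ (diam-mulSet s X≤) (diam-negP (diam-mulSet d X≤)))

diam-embed : ∀ {M} A → (∀ {p} → p ∈ A → proj₁ p ⊔ proj₂ p ≤ M) → Diam≤ M (embed A)
diam-embed {M} A bounded r∈ r′∈ with ∈-map⁻ _ r∈ | ∈-map⁻ _ r′∈
... | (a , a′) , p∈ , refl | (b , b′) , p′∈ , refl =
  coordinate (ℕ.m⊔n≤o⇒m≤o a a′ (bounded p∈)) (ℕ.m⊔n≤o⇒m≤o b b′ (bounded p′∈)) ,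
  coordinate (ℕ.m⊔n≤o⇒n≤o a a′ (bounded p∈)) (ℕ.m⊔n≤o⇒n≤o b b′ (bounded p′∈))
  where
  coordinate : ∀ {i j} → i ≤ M → j ≤ M → ∣ + i - + j ∣ ≤ M
  coordinate {i} {j} i≤M j≤M =
    subst (_≤ M) (cong ∣_∣ (sym (ℤ.[+m]-[+n]≡m⊖n i j))) (ℕ.≤-trans (ℤ.∣m⊝n∣≤m⊔n i j) (ℕ.⊔-lub i≤M j≤M))

direct-digits : ∀ {w m X} → Diam≤ w X → w < m → ∀ Y → DirectSum X ((+ m) ·ˢ Y)
direct-digits {m = m} X≤ w<m Y p∈ p′∈ q∈ q′∈ eq with ∈-map⁻ (scaleP (+ m)) q∈ | ∈-map⁻ (scaleP (+ m)) q′∈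
... | _ , _ , refl | _ , _ , refl =
  cong₂ _,_ (digit-unique m (ℕ.≤-<-trans (proj₁ (X≤ p∈ p′∈)) w<m) (proj₁ (,-injective eq)))
            (digit-unique m (ℕ.≤-<-trans (proj₂ (X≤ p∈ p′∈)) w<m) (proj₂ (,-injective eq)))

maxCoord-bound : ∀ {k} (A : Fin k → List (ℕ × ℕ)) j {p} → p ∈ A j → proj₁ p ⊔ proj₂ p ≤ maxCoord A
maxCoord-bound {k} A j {p} p∈ = outer (allFin k) (∈-allFin j)
  where
  step : ℕ × ℕ → ℕ → ℕ
  step q r = proj₁ q ⊔ proj₂ q ⊔ r
  acc≤ : ∀ acc L → acc ≤ foldr step acc L
  acc≤ acc []      = ℕ.≤-refl
  acc≤ acc (q ∷ L) = ℕ.≤-trans (acc≤ acc L) (ℕ.m≤n⊔m _ _)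
  inner : ∀ acc {L} → p ∈ L → proj₁ p ⊔ proj₂ p ≤ foldr step acc L
  inner acc (here refl)  = ℕ.m≤m⊔n _ _
  inner acc (there p∈L) = ℕ.≤-trans (inner acc p∈L) (ℕ.m≤n⊔m _ _)
  outer : ∀ Js → j ∈ Js → proj₁ p ⊔ proj₂ p ≤ foldr (λ i acc → foldr step acc (A i)) 0 Js
  outer (i ∷ Js) (here refl) = inner _ p∈
  outer (i ∷ Js) (there j∈) = ℕ.≤-trans (outer Js j∈) (acc≤ _ (A i))

map-allFin-suc : ∀ {a} {A : Set a} {k} (F : Fin (suc k) → A) →
                 map F (allFin (suc k)) ≡ F fzero ∷ map (F ∘ fsuc) (allFin k)
map-allFin-suc F = cong (F fzero ∷_) (trans (map-tabulate fsuc F) (sym (map-tabulate (λ j → j) (F ∘ fsuc))))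

·ˢ-identity : ∀ X → (+ 1) ·ˢ X ≡ X
·ˢ-identity X = trans (map-cong scaleP-identity X) (map-id X)

·ˢ-* : ∀ a b X → (+ (a * b)) ·ˢ X ≡ (+ a) ·ˢ ((+ b) ·ˢ X)
·ˢ-* a b X = trans (map-cong (λ p → trans (cong (λ t → scaleP t p) (ℤ.pos-* a b)) (scaleP-* (+ a) (+ b) p)) X)
                  (map-∘ X)

bigSum-·ˢ : ∀ t Xs → bigSum (map (t ·ˢ_) Xs) ≡ t ·ˢ bigSum Xs
bigSum-·ˢ t []       = cong (_∷ []) (sym (scaleP-origin t))
bigSum-·ˢ t (X ∷ Xs) = trans (cong ((t ·ˢ X) +ˢ_) (bigSum-·ˢ t Xs)) (sym (map-+ˢ (scaleP t) (scaleP-⊕ t) X (bigSum Xs)))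

Cset-suc : ∀ {k} m (A : Fin (suc k) → List (ℕ × ℕ)) →
           Cset m A ≡ embed (A fzero) +ˢ ((+ m) ·ˢ Cset m (A ∘ fsuc))
Cset-suc {k} m A = begin
  bigSum (map F (allFin (suc k)))
    ≡⟨ cong bigSum (map-allFin-suc F) ⟩
  F fzero +ˢ bigSum (map (F ∘ fsuc) (allFin k))
    ≡⟨ cong₂ _+ˢ_ (·ˢ-identity (embed (A fzero))) (cong bigSum factor-m) ⟩
  embed (A fzero) +ˢ bigSum (map ((+ m) ·ˢ_) (map G (allFin k)))
    ≡⟨ cong (embed (A fzero) +ˢ_) (bigSum-·ˢ (+ m) (map G (allFin k))) ⟩
  embed (A fzero) +ˢ ((+ m) ·ˢ Cset m (A ∘ fsuc)) ∎
  where
  open ≡-Reasoning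
  F : Fin (suc k) → List Point
  F j = (+ (m ^ toℕ j)) ·ˢ embed (A j)
  G : Fin k → List Point
  G j = (+ (m ^ toℕ j)) ·ˢ embed (A (fsuc j))
  factor-m : map (F ∘ fsuc) (allFin k) ≡ map ((+ m) ·ˢ_) (map G (allFin k))
  factor-m = trans (map-cong (λ j → ·ˢ-* m (m ^ toℕ j) (embed (A (fsuc j)))) (allFin k)) (map-∘ (allFin k))

card-sdSet-origin : ∀ s d → card (sdSet s d (origin ∷ [])) ≡ 1
card-sdSet-origin s d rewrite mulSet-origin s | mulSet-origin d = refl

card-sdSet-Cset : ∀ s d M m → (s + d) * M < m →
  ∀ k (A : Fin k → List (ℕ × ℕ)) → (∀ j → Diam≤ M (embed (A j))) →
  card (sdSet s d (Cset m A)) ≡ product (map (λ j → card (sdSet s d (embed (A j)))) (allFin k))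
card-sdSet-Cset s d M m wide zero    A diam = card-sdSet-origin s d
card-sdSet-Cset s d M m wide (suc k) A diam = begin
  card (sdSet s d (Cset m A))
    ≡⟨ cong (card ∘ sdSet s d) (Cset-suc m A) ⟩
  card (sdSet s d (X₀ +ˢ ((+ m) ·ˢ C)))
    ≡⟨ card-cong (sdSet-+ˢ s d X₀ ((+ m) ·ˢ C)) ⟩
  card (sdSet s d X₀ +ˢ sdSet s d ((+ m) ·ˢ C))
    ≡⟨ cong (λ Z → card (sdSet s d X₀ +ˢ Z)) (sdSet-·ˢ s d (+ m) C) ⟩
  card (sdSet s d X₀ +ˢ ((+ m) ·ˢ sdSet s d C))
    ≡⟨ card-+ˢ _ _ (direct-digits (diam-sdSet s d (diam fzero)) wide (sdSet s d C)) ⟩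
  card (sdSet s d X₀) * card ((+ m) ·ˢ sdSet s d C)
    ≡⟨ cong (card (sdSet s d X₀) *_) (card-map (scaleP (+ m)) (scaleP-injective (+ m)) (sdSet s d C)) ⟩
  card (sdSet s d X₀) * card (sdSet s d C)
    ≡⟨ cong (card (sdSet s d X₀) *_) (card-sdSet-Cset s d M m wide k (A ∘ fsuc) (diam ∘ fsuc)) ⟩
  product (card (sdSet s d X₀) ∷ map (cardSd ∘ fsuc) (allFin k))
    ≡⟨ cong product (map-allFin-suc cardSd) ⟨
  product (map cardSd (allFin (suc k))) ∎
  where
  open ≡-Reasoning
  X₀ = embed (A fzero)
  C  = Cset m (A ∘ fsuc)
  cardSd : Fin (suc k) → ℕ
  cardSd j = card (sdSet s d (embed (A j)))
  instance
    m≢0 : ℕ.NonZero m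
    m≢0 = ℕ.>-nonZero (ℕ.≤-<-trans ℕ.z≤n wide)

lemma3p4 : (k : ℕ) → 1 ≤ k → (A : Fin k → List (ℕ × ℕ)) →
    (∀ j → NonEmpty (A j)) →
    (m : ℕ) → k * maxCoord A < m →
    (s d : ℕ) → s + d ≤ k →
    card (sdSet s d (Cset m A)) ≡ product (map (λ j → card (sdSet s d (embed (A j)))) (allFin k))
lemma3p4 k _ A _ m k*M<m s d s+d≤k =
  card-sdSet-Cset s d M m (ℕ.≤-<-trans (ℕ.*-monoˡ-≤ M s+d≤k) k*M<m) k A
    (λ j → diam-embed (A j) (maxCoord-bound A j))
  where M = maxCoord A
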